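{- There exists a deterministic rendezvous algorithm for the canonical line such that, for arbitrary (distinct) starting nodes of the two agents and an arbitrary delay between their wakeup rounds, the two agents meet within $O(D)$ rounds, where $D$ is the initial distance between the agents. The agents know neither $D$ nor the delay.
   Context: Model: The infinite line is the infinite connected graph in which every node has degree 2. Two mobile agents execute the same deterministic algorithm (agents are anonymous, with unbounded memory). They start at two distinct nodes and are woken up by an adversary in possibly different rounds; the clock of each agent starts in its wakeup round, and rounds are synchronous. In each round an agent either stays idle at its current node or moves to an adjacent node. Agents crossing the same edge in opposite directions in the same round do not notice this. Rendezvous means that both agents are at the same node in the same round; the time of rendezvous is the number of rounds until meeting, counted from the wakeup round of the earlier agent. Canonical line: there is a node $\mathcal{O}$ labeled $1$; the nodes at distance $1,2,3,\dots$ to one side ("right") of $\mathcal{O}$ are labeled $3,5,7,\dots$ and those at distance $1,2,3,\dots$ to the other side ("left") are labeled $2,4,6,\dots$. At every node, port $1$ leads to the right neighbour and port $0$ to the left neighbour. Each agent knows a priori its position in the line: its distance from $\mathcal{O}$ (the smallest-labeled node), on which side of $\mathcal{O}$ it lies, and the direction towards $\mathcal{O}$. -}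

module Defs where

open import Data.Nat using (ℕ; zero; suc; _∸_)
open import Data.Integer using (ℤ; _+_; _-_; +_; -[1+_])

-- Nodes of the canonical line are identified with integers:
-- node O (label 1) is 0, the node at distance d to the right (label 2d+1) is + d,
-- the node at distance d to the left (label 2d) is - d.
-- Knowing "distance from O, side, direction towards O" = knowing this integer.

-- What an agent does in a round: stay idle, take port 0 (left), take port 1 (right).
data Move : Set where
  idle left right : Move

step : Move → ℤ → ℤ
step idle  x = x
step left  x = x - + 1
step right x = x + + 1

-- Before rendezvous an agent on the line observes
-- nothing beyond its a-priori knowledge (its starting node) and its own clock
-- (crossings on an edge are not noticed), so a deterministic algorithm is
-- a function giving, for the starting node and the local round number k,
-- the move performed in local round k+1.
Algorithm : Set
Algorithm = ℤ → ℕ → Move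

posLocal : Algorithm → ℤ → ℕ → ℤ
posLocal A p zero    = p
posLocal A p (suc k) = step (A p k) (posLocal A p k)

-- position at global round t of an agent starting at p and woken in global
-- round w (it stays at p while asleep: t ∸ w = 0 for t ≤ w)
posGlobal : Algorithm → ℤ → ℕ → ℕ → ℤ
posGlobal A p w t = posLocal A p (t ∸ w)

{-# OPTIONS --safe #-}
-- Phase j of the algorithm (16 · 2 ^ j rounds) sweeps [p - 2 ^ j, p + 2 ^ j] around
-- the start p and then, for both shifts s = 0 and s = 2 ^ j, walks to the anchor of p
-- (the largest node ≤ p congruent to s modulo 2 ^ (j + 1)), waits there and returns.
-- Pick 2 ^ i with D ≤ 2 ^ i ≤ 2 D.  If the delay exceeds 2 ^ (i + 5), the later agent
-- is still at its start while the earlier one sweeps radius 2 ^ i ≥ D in phase i.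
-- Otherwise, in phase i + 4 the distance D is less than half the period 2 ^ (i + 5),
-- so for one of the two shifts both starts have the same anchor, and the waiting
-- windows there overlap by more than the delay.  Either way the agents meet before
-- phase i + 5 ends, that is within 16 · 2 ^ (i + 5) ≤ 1024 D rounds.
module Submission where

open import Defs
open import Data.Nat
  using (ℕ; zero; suc; pred; _+_; _∸_; _*_; _^_; _≤_; _<_; z≤n; s≤s; s≤s⁻¹; _≤?_; _<?_; NonZero; ≢-nonZero)
open import Data.Nat.Properties
import Data.Nat.Tactic.RingSolver as ℕ-Solver
open import Data.Integer using (ℤ; +_; -[1+_]; -_; _-_; ∣_∣; +<+)
  renaming (_+_ to _+ᶻ_; _*_ to _*ᶻ_; _<_ to _<ᶻ_; suc to sucᶻ)
open import Data.Integer.DivMod using (_%ℕ_; _/ℕ_; n%ℕd<d; a≡a%ℕn+[a/ℕn]*n)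
import Data.Integer.Properties as ℤ
import Data.Integer.Tactic.RingSolver as ℤ-Solver
open import Data.Product using (Σ; _×_; _,_; uncurry)
open import Data.Sum using (_⊎_; inj₁; inj₂)
import Data.Sum as Sum
open import Function using (const; _∘_)
open import Relation.Nullary using (Dec; yes; no; contradiction)
open import Relation.Binary.Definitions using (tri<; tri≈; tri>)
open import Relation.Binary.PropositionalEquality
  using (_≡_; _≢_; refl; sym; trans; cong; cong₂; subst; module ≡-Reasoning)

Schedule : Set
Schedule = ℕ → Move

walk : Schedule → ℤ → ℕ → ℤ
walk f z zero    = z
walk f z (suc k) = step (f k) (walk f z k)

posLocal≡walk : ∀ A p k → posLocal A p k ≡ walk (A p) p k
posLocal≡walk A p zero    = refl
posLocal≡walk A p (suc k) = cong (step (A p k)) (posLocal≡walk A p k)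

walk-cong : ∀ {f g} z k → (∀ {y} → y < k → f y ≡ g y) → walk f z k ≡ walk g z k
walk-cong z zero    f≗g = refl
walk-cong z (suc k) f≗g = cong₂ step (f≗g ≤-refl) (walk-cong z k (λ y<k → f≗g (m<n⇒m<1+n y<k)))

walk-+ : ∀ f z n k → walk f z (n + k) ≡ walk (λ y → f (n + y)) (walk f z n) k
walk-+ f z n zero    = cong (walk f z) (+-identityʳ n)
walk-+ f z n (suc k) = trans (cong (walk f z) (+-suc n k)) (cong (step (f (n + k))) (walk-+ f z n k))

walk-right : ∀ z n → walk (const right) z n ≡ z +ᶻ + n
walk-right z zero    = sym (ℤ.+-identityʳ z)
walk-right z (suc n) = begin
  walk (const right) z n +ᶻ + 1  ≡⟨ cong (_+ᶻ + 1) (walk-right z n) ⟩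
  z +ᶻ + n +ᶻ + 1                ≡⟨ ℤ.+-assoc z (+ n) (+ 1) ⟩
  z +ᶻ + (n + 1)                 ≡⟨ cong (λ m → z +ᶻ + m) (+-comm n 1) ⟩
  z +ᶻ + suc n                   ∎
  where open ≡-Reasoning

walk-left : ∀ z n → walk (const left) z n ≡ z - + n
walk-left z zero    = sym (ℤ.+-identityʳ z)
walk-left z (suc n) = begin
  walk (const left) z n - + 1  ≡⟨ cong (_- + 1) (walk-left z n) ⟩
  z - + n - + 1                ≡⟨ ℤ.+-assoc z (- + n) (- + 1) ⟩
  z +ᶻ (- + n +ᶻ - + 1)        ≡⟨ cong (z +ᶻ_) (sym (ℤ.neg-distrib-+ (+ n) (+ 1))) ⟩
  z - (+ n +ᶻ + 1)             ≡⟨ cong (λ m → z - + m) (+-comm n 1) ⟩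
  z - + suc n                  ∎
  where open ≡-Reasoning

walk-idle : ∀ z n → walk (const idle) z n ≡ z
walk-idle z zero    = refl
walk-idle z (suc n) = walk-idle z n

infixr 5 _for_then_

_for_then_ : Move → ℕ → Schedule → Schedule
(m for n then g) x with x <? n
... | yes _ = m
... | no  _ = g (x ∸ n)

for-then-< : ∀ m n g {x} → x < n → (m for n then g) x ≡ m
for-then-< m n g {x} x<n with x <? n
... | yes _   = refl
... | no  x≮n = contradiction x<n x≮n

for-then-+ : ∀ m n g y → (m for n then g) (n + y) ≡ g y
for-then-+ m n g y with n + y <? n
... | yes n+y<n = contradiction n+y<n (m+n≮m n y)
... | no  _     = cong g (m+n∸m≡n n y)

walk-for-then-≤ : ∀ m n g z {k} → k ≤ n → walk (m for n then g) z k ≡ walk (const m) z k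
walk-for-then-≤ m n g z {k} k≤n = walk-cong z k (λ y<k → for-then-< m n g (<-≤-trans y<k k≤n))

walk-for-then-+ : ∀ m n g z k → walk (m for n then g) z (n + k) ≡ walk g (walk (const m) z n) k
walk-for-then-+ m n g z k = begin
  walk (m for n then g) z (n + k)                                  ≡⟨ walk-+ (m for n then g) z n k ⟩
  walk (λ y → (m for n then g) (n + y)) (walk (m for n then g) z n) k
                                                                   ≡⟨ cong (λ w → walk _ w k) (walk-for-then-≤ m n g z ≤-refl) ⟩
  walk (λ y → (m for n then g) (n + y)) (walk (const m) z n) k     ≡⟨ walk-cong _ k (λ {y} _ → for-then-+ m n g y) ⟩
  walk g (walk (const m) z n) k                                    ∎
  where open ≡-Reasoning

sweep : ℕ → Schedule → Schedule
sweep R g = right for R then left for R + R then right for R then g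

walk-sweep-out : ∀ R g z {e} → e ≤ R → walk (sweep R g) z e ≡ z +ᶻ + e
walk-sweep-out R g z {e} e≤R = trans (walk-for-then-≤ right R _ z e≤R) (walk-right z e)

walk-sweep-back : ∀ R g z {e} → e ≤ R → walk (sweep R g) z (R + (R + e)) ≡ z - + e
walk-sweep-back R g z {e} e≤R = begin
  walk (sweep R g) z (R + (R + e))                       ≡⟨ walk-for-then-+ right R _ z (R + e) ⟩
  walk (left for R + R then _) (walk (const right) z R) (R + e)
                                                         ≡⟨ walk-for-then-≤ left (R + R) _ _ (+-monoʳ-≤ R e≤R) ⟩
  walk (const left) (walk (const right) z R) (R + e)     ≡⟨ walk-left _ (R + e) ⟩
  walk (const right) z R - + (R + e)                     ≡⟨ cong (_- + (R + e)) (walk-right z R) ⟩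
  z +ᶻ + R - (+ R +ᶻ + e)                                ≡⟨ cancel z (+ R) (+ e) ⟩
  z - + e                                                ∎
  where
  open ≡-Reasoning
  cancel : ∀ z r e → z +ᶻ r - (r +ᶻ e) ≡ z - e
  cancel = ℤ-Solver.solve-∀

walk-sweep-end : ∀ R g z k → walk (sweep R g) z (4 * R + k) ≡ walk g z k
walk-sweep-end R g z k = begin
  walk (sweep R g) z (4 * R + k)                        ≡⟨ cong (walk (sweep R g) z) (split R k) ⟩
  walk (sweep R g) z (R + ((R + R) + (R + k)))          ≡⟨ walk-for-then-+ right R _ z _ ⟩
  walk (left for R + R then _) z₁ ((R + R) + (R + k))   ≡⟨ walk-for-then-+ left (R + R) _ z₁ _ ⟩
  walk (right for R then g) z₂ (R + k)                  ≡⟨ walk-for-then-+ right R g z₂ k ⟩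
  walk g (walk (const right) z₂ R) k                    ≡⟨ cong (λ w → walk g w k) back-home ⟩
  walk g z k                                            ∎
  where
  open ≡-Reasoning
  z₁ = walk (const right) z R
  z₂ = walk (const left) z₁ (R + R)
  split : ∀ R k → 4 * R + k ≡ R + ((R + R) + (R + k))
  split = ℕ-Solver.solve-∀
  cancel : ∀ z r → z +ᶻ r - (r +ᶻ r) +ᶻ r ≡ z
  cancel = ℤ-Solver.solve-∀
  back-home : walk (const right) z₂ R ≡ z
  back-home = begin
    walk (const right) z₂ R                ≡⟨ walk-right z₂ R ⟩
    z₂ +ᶻ + R                              ≡⟨ cong (_+ᶻ + R) (walk-left z₁ (R + R)) ⟩
    z₁ - + (R + R) +ᶻ + R                  ≡⟨ cong (λ w → w - + (R + R) +ᶻ + R) (walk-right z R) ⟩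
    z +ᶻ + R - (+ R +ᶻ + R) +ᶻ + R         ≡⟨ cancel z (+ R) ⟩
    z                                      ∎

gather : ℕ → ℕ → Schedule → Schedule
gather L d g = left for d then idle for L ∸ (d + d) then right for d then g

walk-gather-hold : ∀ L d g z {y} → d ≤ y → y + d ≤ L → walk (gather L d g) z y ≡ z - + d
walk-gather-hold L d g z {y} d≤y y+d≤L = begin
  walk (gather L d g) z y                                         ≡⟨ cong (walk (gather L d g) z) (sym y≡d+w) ⟩
  walk (gather L d g) z (d + w)                                   ≡⟨ walk-for-then-+ left d _ z w ⟩
  walk (idle for L ∸ (d + d) then _) (walk (const left) z d) w    ≡⟨ walk-for-then-≤ idle (L ∸ (d + d)) _ _ w≤ ⟩
  walk (const idle) (walk (const left) z d) w                     ≡⟨ walk-idle _ w ⟩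
  walk (const left) z d                                           ≡⟨ walk-left z d ⟩
  z - + d                                                         ∎
  where
  open ≡-Reasoning
  w = y ∸ d
  y≡d+w : d + w ≡ y
  y≡d+w = m+[n∸m]≡n d≤y
  regroup : ∀ w d → d + w + d ≡ w + (d + d)
  regroup = ℕ-Solver.solve-∀
  w≤ : w ≤ L ∸ (d + d)
  w≤ = m+n≤o⇒m≤o∸n w (≤-trans (≤-reflexive (trans (sym (regroup w d)) (cong (_+ d) y≡d+w))) y+d≤L)

walk-gather-end : ∀ L d g z k → d + d ≤ L → walk (gather L d g) z (L + k) ≡ walk g z k
walk-gather-end L d g z k 2d≤L = begin
  walk (gather L d g) z (L + k)                         ≡⟨ cong (walk (gather L d g) z) L+k≡ ⟩
  walk (gather L d g) z (d + (W + (d + k)))             ≡⟨ walk-for-then-+ left d _ z _ ⟩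
  walk (idle for W then _) z₁ (W + (d + k))             ≡⟨ walk-for-then-+ idle W _ z₁ _ ⟩
  walk (right for d then g) (walk (const idle) z₁ W) (d + k)
                                                        ≡⟨ walk-for-then-+ right d g _ k ⟩
  walk g (walk (const right) (walk (const idle) z₁ W) d) k
                                                        ≡⟨ cong (λ w → walk g w k) back-home ⟩
  walk g z k                                            ∎
  where
  open ≡-Reasoning
  W = L ∸ (d + d)
  z₁ = walk (const left) z d
  regroup : ∀ W d k → W + (d + d) + k ≡ d + (W + (d + k))
  regroup = ℕ-Solver.solve-∀
  L+k≡ : L + k ≡ d + (W + (d + k))
  L+k≡ = trans (cong (_+ k) (sym (m∸n+n≡m 2d≤L))) (regroup W d k)
  cancel : ∀ z d → z - d +ᶻ d ≡ z
  cancel = ℤ-Solver.solve-∀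
  back-home : walk (const right) (walk (const idle) z₁ W) d ≡ z
  back-home = begin
    walk (const right) (walk (const idle) z₁ W) d   ≡⟨ walk-right _ d ⟩
    walk (const idle) z₁ W +ᶻ + d                   ≡⟨ cong (_+ᶻ + d) (trans (walk-idle z₁ W) (walk-left z d)) ⟩
    z - + d +ᶻ + d                                  ≡⟨ cancel z (+ d) ⟩
    z                                               ∎

quotient-increasing : ∀ {n r r'} {b b' : ℤ} → b <ᶻ b' → r < n → + r +ᶻ b *ᶻ + n <ᶻ + r' +ᶻ b' *ᶻ + n
quotient-increasing {n} {r} {r'} {b} {b'} b<b' r<n = begin-strict
  + r +ᶻ b *ᶻ + n          <⟨ ℤ.+-monoˡ-< (b *ᶻ + n) (+<+ r<n) ⟩
  + n +ᶻ b *ᶻ + n          ≡⟨ sym (ℤ.suc-* b (+ n)) ⟩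
  sucᶻ b *ᶻ + n            ≤⟨ ℤ.*-monoʳ-≤-nonNeg (+ n) (ℤ.i<j⇒suc[i]≤j b<b') ⟩
  b' *ᶻ + n                ≤⟨ ℤ.i≤j+i (b' *ᶻ + n) (+ r') ⟩
  + r' +ᶻ b' *ᶻ + n        ∎
  where open ℤ.≤-Reasoning

remainder-unique : ∀ {n r r'} (b b' : ℤ) → r < n → r' < n →
                   + r +ᶻ b *ᶻ + n ≡ + r' +ᶻ b' *ᶻ + n → r ≡ r'
remainder-unique {n} {r} {r'} b b' r<n r'<n eq with ℤ.<-cmp b b'
... | tri< b<b' _ _ = contradiction eq (ℤ.<⇒≢ (quotient-increasing b<b' r<n))
... | tri> _ _ b>b' = contradiction (sym eq) (ℤ.<⇒≢ (quotient-increasing b>b' r'<n))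
... | tri≈ _ refl _ = ℤ.+-injective (begin
  + r                             ≡⟨ sym (cancel (+ r) (b *ᶻ + n)) ⟩
  + r +ᶻ b *ᶻ + n - b *ᶻ + n      ≡⟨ cong (_- b *ᶻ + n) eq ⟩
  + r' +ᶻ b *ᶻ + n - b *ᶻ + n     ≡⟨ cancel (+ r') (b *ᶻ + n) ⟩
  + r'                            ∎)
  where
  open ≡-Reasoning
  cancel : ∀ x y → x +ᶻ y - y ≡ x
  cancel = ℤ-Solver.solve-∀

%ℕ-translate : ∀ x n .{{_ : NonZero n}} (c : ℤ) {r} → + (x %ℕ n) +ᶻ c ≡ + r → r < n →
               (x +ᶻ c) %ℕ n ≡ r
%ℕ-translate x n c {r} shifted r<n =
  remainder-unique ((x +ᶻ c) /ℕ n) (x /ℕ n) (n%ℕd<d (x +ᶻ c) n) r<n (begin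
    + ((x +ᶻ c) %ℕ n) +ᶻ (x +ᶻ c) /ℕ n *ᶻ + n  ≡⟨ sym (a≡a%ℕn+[a/ℕn]*n (x +ᶻ c) n) ⟩
    x +ᶻ c                                    ≡⟨ cong (_+ᶻ c) (a≡a%ℕn+[a/ℕn]*n x n) ⟩
    + (x %ℕ n) +ᶻ x /ℕ n *ᶻ + n +ᶻ c          ≡⟨ regroup (+ (x %ℕ n)) (x /ℕ n *ᶻ + n) c ⟩
    + (x %ℕ n) +ᶻ c +ᶻ x /ℕ n *ᶻ + n          ≡⟨ cong (_+ᶻ x /ℕ n *ᶻ + n) shifted ⟩
    + r +ᶻ x /ℕ n *ᶻ + n                      ∎)
  where
  open ≡-Reasoning
  regroup : ∀ r q c → r +ᶻ q +ᶻ c ≡ r +ᶻ c +ᶻ q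
  regroup = ℤ-Solver.solve-∀

residue : ℕ → ℕ → ℤ → ℕ
residue k s x = (x - + s) %ℕ 2 ^ k
  where instance _ = m^n≢0 2 k

anchor : ℕ → ℕ → ℤ → ℤ
anchor k s x = x - + residue k s x

residue<2^ : ∀ k s x → residue k s x < 2 ^ k
residue<2^ k s x = n%ℕd<d (x - + s) (2 ^ k)
  where instance _ = m^n≢0 2 k

anchor-+ : ∀ k s x e → residue k s x + e < 2 ^ k → anchor k s (x +ᶻ + e) ≡ anchor k s x
anchor-+ k s x e r+e<2^k = begin
  x +ᶻ + e - + ((x +ᶻ + e - + s) %ℕ 2 ^ k)
    ≡⟨ cong (λ y → x +ᶻ + e - + (y %ℕ 2 ^ k)) (swap x (+ e) (+ s)) ⟩
  x +ᶻ + e - + ((x - + s +ᶻ + e) %ℕ 2 ^ k)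
    ≡⟨ cong (λ r → x +ᶻ + e - + r) (%ℕ-translate (x - + s) (2 ^ k) (+ e) refl r+e<2^k) ⟩
  x +ᶻ + e - (+ residue k s x +ᶻ + e)        ≡⟨ cancel x (+ e) (+ residue k s x) ⟩
  anchor k s x                               ∎
  where
  open ≡-Reasoning
  instance _ = m^n≢0 2 k
  swap : ∀ x e s → x +ᶻ e - s ≡ x - s +ᶻ e
  swap = ℤ-Solver.solve-∀
  cancel : ∀ x e r → x +ᶻ e - (r +ᶻ e) ≡ x - r
  cancel = ℤ-Solver.solve-∀

residue-shift : ∀ k s h x {r} → residue k s x ≡ h + r → residue k (s + h) x ≡ r
residue-shift k s h x {r} eq = begin
  (x - (+ s +ᶻ + h)) %ℕ 2 ^ k     ≡⟨ cong (_%ℕ 2 ^ k) (regroup x (+ s) (+ h)) ⟩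
  (x - + s +ᶻ - + h) %ℕ 2 ^ k     ≡⟨ %ℕ-translate (x - + s) (2 ^ k) (- + h) shifted r<2^k ⟩
  r                               ∎
  where
  open ≡-Reasoning
  instance _ = m^n≢0 2 k
  regroup : ∀ x s h → x - (s +ᶻ h) ≡ x - s +ᶻ - h
  regroup = ℤ-Solver.solve-∀
  cancel : ∀ h r → h +ᶻ r +ᶻ - h ≡ r
  cancel = ℤ-Solver.solve-∀
  shifted : + residue k s x +ᶻ - + h ≡ + r
  shifted = trans (cong (λ m → + m +ᶻ - + h) eq) (cancel (+ h) (+ r))
  r<2^k : r < 2 ^ k
  r<2^k = ≤-<-trans (m≤n+m r h) (subst (_< 2 ^ k) eq (residue<2^ k s x))

+-<-double : ∀ {m k n} → m < n → k < n → m + k < 2 * n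
+-<-double {n = n} m<n k<n = <-≤-trans (+-mono-< m<n k<n) (≤-reflexive (cong (λ m → n + m) (sym (+-identityʳ n))))

same-anchor : ∀ j x e → e < 2 ^ j →
  anchor (suc j) 0 (x +ᶻ + e) ≡ anchor (suc j) 0 x ⊎ anchor (suc j) (2 ^ j) (x +ᶻ + e) ≡ anchor (suc j) (2 ^ j) x
same-anchor j x e e<h = by-cases (r <? 2 ^ j)
  where
  r = residue (suc j) 0 x
  by-cases : Dec (r < 2 ^ j) →
    anchor (suc j) 0 (x +ᶻ + e) ≡ anchor (suc j) 0 x ⊎ anchor (suc j) (2 ^ j) (x +ᶻ + e) ≡ anchor (suc j) (2 ^ j) x
  by-cases (yes r<h) = inj₁ (anchor-+ (suc j) 0 x e (+-<-double r<h e<h))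
  by-cases (no  r≮h) =
    inj₂ (anchor-+ (suc j) (2 ^ j) x e (subst (λ r → r + e < 2 ^ suc j) (sym shifted) (+-<-double r'<h e<h)))
    where
    r≡h+r' : r ≡ 2 ^ j + (r ∸ 2 ^ j)
    r≡h+r' = sym (m+[n∸m]≡n (≮⇒≥ r≮h))
    shifted : residue (suc j) (2 ^ j) x ≡ r ∸ 2 ^ j
    shifted = residue-shift (suc j) 0 (2 ^ j) x r≡h+r'
    r'<h : r ∸ 2 ^ j < 2 ^ j
    r'<h = ≤-trans (+-cancelˡ-< (2 ^ j) (r ∸ 2 ^ j) (2 ^ j + 0) (subst (_< 2 ^ suc j) r≡h+r' (residue<2^ (suc j) 0 x)))
                   (≤-reflexive (+-identityʳ (2 ^ j)))

2R+2R+2R≡6R : ∀ R → 2 * R + 2 * R + 2 * R ≡ 6 * R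
2R+2R+2R≡6R = ℕ-Solver.solve-∀

gather-fits : ∀ R {d} → d < 2 * R → d + d ≤ 6 * R
gather-fits R {d} d<2R = begin
  d + d                      ≤⟨ +-mono-≤ (<⇒≤ d<2R) (<⇒≤ d<2R) ⟩
  2 * R + 2 * R              ≤⟨ m≤m+n (2 * R + 2 * R) (2 * R) ⟩
  2 * R + 2 * R + 2 * R      ≡⟨ 2R+2R+2R≡6R R ⟩
  6 * R                      ∎
  where open ≤-Reasoning

gather-window : ∀ R g z {d y} → d < 2 * R → y ≤ 2 * R → walk (gather (6 * R) d g) z (2 * R + y) ≡ z - + d
gather-window R g z {d} {y} d<2R y≤2R =
  walk-gather-hold (6 * R) d g z (≤-trans (<⇒≤ d<2R) (m≤m+n (2 * R) y)) (begin
    2 * R + y + d              ≤⟨ +-mono-≤ (+-monoʳ-≤ (2 * R) y≤2R) (<⇒≤ d<2R) ⟩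
    2 * R + 2 * R + 2 * R      ≡⟨ 2R+2R+2R≡6R R ⟩
    6 * R                      ∎)
  where open ≤-Reasoning

phase : ℤ → ℕ → Schedule
phase p j = sweep R (gather (6 * R) (residue (suc j) 0 p) (gather (6 * R) (residue (suc j) R p) (const idle)))
  where R = 2 ^ j

phaseLength : ℕ → ℕ
phaseLength j = 16 * 2 ^ j

walk-phase-loop : ∀ p j z → walk (phase p j) z (phaseLength j) ≡ z
walk-phase-loop p j z = begin
  walk (phase p j) z (16 * R)                                  ≡⟨ cong (walk (phase p j) z) (split R) ⟩
  walk (phase p j) z (4 * R + (6 * R + (6 * R + 0)))           ≡⟨ walk-sweep-end R _ z _ ⟩
  walk (gather (6 * R) d₀ (gather (6 * R) d₁ (const idle))) z (6 * R + (6 * R + 0))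
                                                               ≡⟨ walk-gather-end (6 * R) d₀ _ z _ (gather-fits R (residue<2^ (suc j) 0 p)) ⟩
  walk (gather (6 * R) d₁ (const idle)) z (6 * R + 0)
                                                               ≡⟨ walk-gather-end (6 * R) d₁ _ z 0 (gather-fits R (residue<2^ (suc j) R p)) ⟩
  z                                                            ∎
  where
  open ≡-Reasoning
  R = 2 ^ j
  d₀ = residue (suc j) 0 p
  d₁ = residue (suc j) R p
  split : ∀ R → 16 * R ≡ 4 * R + (6 * R + (6 * R + 0))
  split = ℕ-Solver.solve-∀

WaitsAtAnchor : ℕ → ℕ → ℕ → Set
WaitsAtAnchor j s b = ∀ x {y} → y ≤ 2 * 2 ^ j → walk (phase x j) x (b + (2 * 2 ^ j + y)) ≡ anchor (suc j) s x

first-gather-waits : ∀ j → WaitsAtAnchor j 0 (4 * 2 ^ j)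
first-gather-waits j x y≤ = trans (walk-sweep-end (2 ^ j) _ x _) (gather-window (2 ^ j) _ x (residue<2^ (suc j) 0 x) y≤)

second-gather-waits : ∀ j → WaitsAtAnchor j (2 ^ j) (10 * 2 ^ j)
second-gather-waits j x {y} y≤ = begin
  walk (phase x j) x (10 * R + k)                              ≡⟨ cong (walk (phase x j) x) (split R k) ⟩
  walk (phase x j) x (4 * R + (6 * R + k))                     ≡⟨ walk-sweep-end R _ x _ ⟩
  walk (gather (6 * R) d₀ _) x (6 * R + k)                     ≡⟨ walk-gather-end (6 * R) d₀ _ x k (gather-fits R (residue<2^ (suc j) 0 x)) ⟩
  walk (gather (6 * R) (residue (suc j) R x) (const idle)) x k ≡⟨ gather-window R _ x (residue<2^ (suc j) R x) y≤ ⟩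
  anchor (suc j) R x                                           ∎
  where
  open ≡-Reasoning
  R = 2 ^ j
  k = 2 * R + y
  d₀ = residue (suc j) 0 x
  split : ∀ R k → 10 * R + k ≡ 4 * R + (6 * R + k)
  split = ℕ-Solver.solve-∀

phaseStart : ℕ → ℕ
phaseStart zero    = 0
phaseStart (suc j) = phaseStart j + phaseLength j

tick : ℕ × ℕ → ℕ × ℕ
tick (j , x) with suc x <? phaseLength j
... | yes _ = j , suc x
... | no  _ = suc j , 0

clock : ℕ → ℕ × ℕ
clock zero    = 0 , 0
clock (suc k) = tick (clock k)

rendezvous : Algorithm
rendezvous p k = uncurry (phase p) (clock k)

tick-< : ∀ j x → suc x < phaseLength j → tick (j , x) ≡ (j , suc x)
tick-< j x sx<L with suc x <? phaseLength j
... | yes _    = refl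
... | no  sx≮L = contradiction sx<L sx≮L

tick-last : ∀ j x → suc x ≡ phaseLength j → tick (j , x) ≡ (suc j , 0)
tick-last j x sx≡L with suc x <? phaseLength j
... | yes sx<L = contradiction sx≡L (<⇒≢ sx<L)
... | no  _    = refl

clock-within : ∀ j → clock (phaseStart j) ≡ (j , 0) → ∀ x → x < phaseLength j → clock (phaseStart j + x) ≡ (j , x)
clock-within j start zero    _    = trans (cong clock (+-identityʳ (phaseStart j))) start
clock-within j start (suc x) sx<L = begin
  clock (phaseStart j + suc x)     ≡⟨ cong clock (+-suc (phaseStart j) x) ⟩
  tick (clock (phaseStart j + x))  ≡⟨ cong tick (clock-within j start x (<-trans (n<1+n x) sx<L)) ⟩
  tick (j , x)                     ≡⟨ tick-< j x sx<L ⟩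
  j , suc x                        ∎
  where open ≡-Reasoning

clock-phaseStart : ∀ j → clock (phaseStart j) ≡ (j , 0)
clock-phaseStart zero    = refl
clock-phaseStart (suc j) = begin
  clock (phaseStart j + phaseLength j)      ≡⟨ cong (λ n → clock (phaseStart j + n)) (sym L≡sx) ⟩
  clock (phaseStart j + suc x)              ≡⟨ cong clock (+-suc (phaseStart j) x) ⟩
  tick (clock (phaseStart j + x))           ≡⟨ cong tick (clock-within j (clock-phaseStart j) x x<L) ⟩
  tick (j , x)                              ≡⟨ tick-last j x L≡sx ⟩
  suc j , 0                                 ∎
  where
  open ≡-Reasoning
  instance _ = m*n≢0 16 (2 ^ j) {{_}} {{m^n≢0 2 j}}
  x = pred (phaseLength j)
  L≡sx : suc x ≡ phaseLength j
  L≡sx = suc-pred (phaseLength j)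
  x<L : x < phaseLength j
  x<L = subst (x <_) L≡sx (n<1+n x)

rendezvous-in-phase : ∀ p j {x} → x < phaseLength j → rendezvous p (phaseStart j + x) ≡ phase p j x
rendezvous-in-phase p j {x} x<L = cong (uncurry (phase p)) (clock-within j (clock-phaseStart j) x x<L)

walk-rendezvous-phase : ∀ p j z {x} → x ≤ phaseLength j →
  walk (rendezvous p) z (phaseStart j + x) ≡ walk (phase p j) (walk (rendezvous p) z (phaseStart j)) x
walk-rendezvous-phase p j z {x} x≤L =
  trans (walk-+ (rendezvous p) z (phaseStart j) x)
        (walk-cong _ x (λ y<x → rendezvous-in-phase p j (<-≤-trans y<x x≤L)))

rendezvous-returns : ∀ p j → walk (rendezvous p) p (phaseStart j) ≡ p
rendezvous-returns p zero    = refl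
rendezvous-returns p (suc j) = begin
  walk (rendezvous p) p (phaseStart j + phaseLength j)                          ≡⟨ walk-rendezvous-phase p j p ≤-refl ⟩
  walk (phase p j) (walk (rendezvous p) p (phaseStart j)) (phaseLength j)       ≡⟨ walk-phase-loop p j _ ⟩
  walk (rendezvous p) p (phaseStart j)                                          ≡⟨ rendezvous-returns p j ⟩
  p                                                                             ∎
  where open ≡-Reasoning

position-in-phase : ∀ p j {x} → x ≤ phaseLength j →
  posLocal rendezvous p (phaseStart j + x) ≡ walk (phase p j) p x
position-in-phase p j {x} x≤L = begin
  posLocal rendezvous p (phaseStart j + x)                   ≡⟨ posLocal≡walk rendezvous p (phaseStart j + x) ⟩
  walk (rendezvous p) p (phaseStart j + x)                   ≡⟨ walk-rendezvous-phase p j p x≤L ⟩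
  walk (phase p j) (walk (rendezvous p) p (phaseStart j)) x  ≡⟨ cong (λ z → walk (phase p j) z x) (rendezvous-returns p j) ⟩
  walk (phase p j) p x                                       ∎
  where open ≡-Reasoning

phaseStart-bound : ∀ j → phaseStart j ≤ 16 * 2 ^ j
phaseStart-bound zero    = z≤n
phaseStart-bound (suc j) = begin
  phaseStart j + 16 * 2 ^ j       ≤⟨ +-monoˡ-≤ (16 * 2 ^ j) (phaseStart-bound j) ⟩
  16 * 2 ^ j + 16 * 2 ^ j         ≡⟨ double (2 ^ j) ⟩
  16 * 2 ^ suc j                  ∎
  where
  open ≤-Reasoning
  double : ∀ R → 16 * R + 16 * R ≡ 16 * (2 * R)
  double = ℕ-Solver.solve-∀

MeetsBy : ℤ → ℤ → ℕ → ℕ → Set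
MeetsBy p q θ T = Σ ℕ λ t → t ≤ T × posGlobal rendezvous p 0 t ≡ posGlobal rendezvous q θ t

MeetsBy-mono : ∀ p q θ {T T'} → T ≤ T' → MeetsBy p q θ T → MeetsBy p q θ T'
MeetsBy-mono p q θ T≤T' (t , t≤T , met) = t , ≤-trans t≤T T≤T' , met

asleep : ∀ A q {θ t} → t ≤ θ → posGlobal A q θ t ≡ q
asleep A q t≤θ = cong (posLocal A q) (m≤n⇒m∸n≡0 t≤θ)

sweep-in-phase : ∀ j {x} → x ≤ 2 ^ j + (2 ^ j + 2 ^ j) → x ≤ phaseLength j
sweep-in-phase j {x} x≤3R = ≤-trans x≤3R (≤-trans (m≤m+n _ (13 * 2 ^ j)) (≤-reflexive (sixteen (2 ^ j))))
  where
  sixteen : ∀ R → R + (R + R) + 13 * R ≡ 16 * R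
  sixteen = ℕ-Solver.solve-∀

meet-by-sweep : ∀ i p q θ D → D ≤ 2 ^ i → q ≡ p +ᶻ + D ⊎ p ≡ q +ᶻ + D →
  phaseStart (suc i) ≤ θ → MeetsBy p q θ (phaseStart (suc i))
meet-by-sweep i p q θ D D≤R (inj₁ q≡p+D) end≤θ = t , t≤end , (begin
  posLocal rendezvous p t             ≡⟨ position-in-phase p i D≤L ⟩
  walk (phase p i) p D                ≡⟨ walk-sweep-out (2 ^ i) _ p D≤R ⟩
  p +ᶻ + D                            ≡⟨ sym q≡p+D ⟩
  q                                   ≡⟨ sym (asleep rendezvous q (≤-trans t≤end end≤θ)) ⟩
  posGlobal rendezvous q θ t          ∎)
  where
  open ≡-Reasoning
  R = 2 ^ i
  t = phaseStart i + D
  D≤L : D ≤ phaseLength i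
  D≤L = sweep-in-phase i (≤-trans D≤R (m≤m+n R (R + R)))
  t≤end : t ≤ phaseStart (suc i)
  t≤end = +-monoʳ-≤ (phaseStart i) D≤L
meet-by-sweep i p q θ D D≤R (inj₂ p≡q+D) end≤θ = t , t≤end , (begin
  posLocal rendezvous p t                 ≡⟨ position-in-phase p i x≤L ⟩
  walk (phase p i) p (R + (R + D))        ≡⟨ walk-sweep-back R _ p D≤R ⟩
  p - + D                                 ≡⟨ cong (_- + D) p≡q+D ⟩
  q +ᶻ + D - + D                          ≡⟨ cancel q (+ D) ⟩
  q                                       ≡⟨ sym (asleep rendezvous q (≤-trans t≤end end≤θ)) ⟩
  posGlobal rendezvous q θ t              ∎)
  where
  open ≡-Reasoning
  R = 2 ^ i
  t = phaseStart i + (R + (R + D))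
  x≤L : R + (R + D) ≤ phaseLength i
  x≤L = sweep-in-phase i (+-monoʳ-≤ R (+-monoʳ-≤ R D≤R))
  t≤end : t ≤ phaseStart (suc i)
  t≤end = +-monoʳ-≤ (phaseStart i) x≤L
  cancel : ∀ q d → q +ᶻ d - d ≡ q
  cancel = ℤ-Solver.solve-∀

meet-at-anchor : ∀ j s b p q θ → WaitsAtAnchor j s b → b + 4 * 2 ^ j ≤ phaseLength j → θ ≤ 2 * 2 ^ j →
  anchor (suc j) s p ≡ anchor (suc j) s q → MeetsBy p q θ (phaseStart (suc j))
meet-at-anchor j s b p q θ waits fits θ≤2R same = t , t≤end , (begin
  posLocal rendezvous p t                                   ≡⟨ position-in-phase p j x≤L ⟩
  walk (phase p j) p (b + (2 * R + θ))                      ≡⟨ waits p θ≤2R ⟩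
  anchor (suc j) s p                                        ≡⟨ same ⟩
  anchor (suc j) s q                                        ≡⟨ sym (waits q z≤n) ⟩
  walk (phase q j) q (b + (2 * R + 0))                      ≡⟨ sym (position-in-phase q j x₀≤L) ⟩
  posLocal rendezvous q (phaseStart j + (b + (2 * R + 0)))  ≡⟨ cong (posLocal rendezvous q) (sym t∸θ≡) ⟩
  posGlobal rendezvous q θ t                                ∎)
  where
  open ≡-Reasoning
  R = 2 ^ j
  t = phaseStart j + (b + (2 * R + θ))
  four : ∀ R → 2 * R + 2 * R ≡ 4 * R
  four = ℕ-Solver.solve-∀
  x≤L : b + (2 * R + θ) ≤ phaseLength j
  x≤L = ≤-trans (+-monoʳ-≤ b (≤-trans (+-monoʳ-≤ (2 * R) θ≤2R) (≤-reflexive (four R)))) fits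
  x₀≤L : b + (2 * R + 0) ≤ phaseLength j
  x₀≤L = ≤-trans (+-monoʳ-≤ b (+-monoʳ-≤ (2 * R) z≤n)) x≤L
  regroup : ∀ P b r θ → P + (b + (r + θ)) ≡ P + (b + (r + 0)) + θ
  regroup = ℕ-Solver.solve-∀
  t∸θ≡ : t ∸ θ ≡ phaseStart j + (b + (2 * R + 0))
  t∸θ≡ = trans (cong (_∸ θ) (regroup (phaseStart j) b (2 * R) θ)) (m+n∸n≡m _ θ)
  t≤end : t ≤ phaseStart (suc j)
  t≤end = +-monoʳ-≤ (phaseStart j) x≤L

meet-by-gathering : ∀ j p q θ D → D < 2 ^ j → q ≡ p +ᶻ + D ⊎ p ≡ q +ᶻ + D →
  θ ≤ 2 * 2 ^ j → MeetsBy p q θ (phaseStart (suc j))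
meet-by-gathering j p q θ D D<R dir θ≤2R = by-shift (common-anchor dir)
  where
  R = 2 ^ j
  Common : ℕ → Set
  Common s = anchor (suc j) s p ≡ anchor (suc j) s q
  common-anchor : q ≡ p +ᶻ + D ⊎ p ≡ q +ᶻ + D → Common 0 ⊎ Common R
  common-anchor (inj₁ q≡p+D) rewrite q≡p+D = Sum.map sym sym (same-anchor j p D D<R)
  common-anchor (inj₂ p≡q+D) rewrite p≡q+D = same-anchor j q D D<R
  fits : ∀ b c → b + 4 * R + c ≡ 16 * R → b + 4 * R ≤ phaseLength j
  fits b c sum = ≤-trans (m≤m+n _ c) (≤-reflexive sum)
  first : ∀ R → 4 * R + 4 * R + 8 * R ≡ 16 * R
  first = ℕ-Solver.solve-∀
  second : ∀ R → 10 * R + 4 * R + 2 * R ≡ 16 * R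
  second = ℕ-Solver.solve-∀
  by-shift : Common 0 ⊎ Common R → MeetsBy p q θ (phaseStart (suc j))
  by-shift (inj₁ same) = meet-at-anchor j 0 (4 * R) p q θ (first-gather-waits j) (fits (4 * R) (8 * R) (first R)) θ≤2R same
  by-shift (inj₂ same) =
    meet-at-anchor j R (10 * R) p q θ (second-gather-waits j) (fits (10 * R) (2 * R) (second R)) θ≤2R same

dyadic-bracket : ∀ D .{{_ : NonZero D}} → Σ ℕ λ i → D ≤ 2 ^ i × 2 ^ i ≤ 2 * D
dyadic-bracket (suc zero)    = 0 , ≤-refl , s≤s z≤n
dyadic-bracket (suc (suc n)) with dyadic-bracket (suc n)
... | i , n<2^i , 2^i≤2n with suc (suc n) ≤? 2 ^ i
...   | yes 2+n≤2^i = i , 2+n≤2^i , ≤-trans 2^i≤2n (*-monoʳ-≤ 2 (n≤1+n (suc n)))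
...   | no  2+n≰2^i = suc i , lower , upper
  where
  2^i≡1+n : 2 ^ i ≡ suc n
  2^i≡1+n = ≤-antisym (s≤s⁻¹ (≰⇒> 2+n≰2^i)) n<2^i
  doubled : ∀ n → suc (suc n) + n ≡ 2 * suc n
  doubled = ℕ-Solver.solve-∀
  lower : suc (suc n) ≤ 2 * 2 ^ i
  lower = ≤-trans (m≤m+n (suc (suc n)) n) (≤-reflexive (trans (doubled n) (cong (2 *_) (sym 2^i≡1+n))))
  upper : 2 * 2 ^ i ≤ 2 * suc (suc n)
  upper = *-monoʳ-≤ 2 (≤-trans (≤-reflexive 2^i≡1+n) (n≤1+n (suc n)))

meets-within : ∀ p q θ D i → D ≤ 2 ^ i → 2 ^ i ≤ 2 * D → q ≡ p +ᶻ + D ⊎ p ≡ q +ᶻ + D →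
  MeetsBy p q θ (1024 * D)
meets-within p q θ D i D≤r r≤2D dir = by-delay (θ ≤? 2 * 2 ^ (4 + i))
  where
  r = 2 ^ i
  closed-form : ∀ r → 16 * (2 * (2 * (2 * (2 * (2 * r))))) ≡ 512 * r
  closed-form = ℕ-Solver.solve-∀
  deadline : 16 * 2 ^ (5 + i) ≤ 1024 * D
  deadline = begin
    16 * 2 ^ (5 + i)    ≡⟨ closed-form r ⟩
    512 * r             ≤⟨ *-monoʳ-≤ 512 r≤2D ⟩
    512 * (2 * D)       ≡⟨ sym (*-assoc 512 2 D) ⟩
    1024 * D            ∎
    where open ≤-Reasoning
  sweep-deadline : phaseStart (suc i) ≤ 1024 * D
  sweep-deadline = ≤-trans (phaseStart-bound (suc i))
                     (≤-trans (*-monoʳ-≤ 16 (^-monoʳ-≤ 2 (s≤s (m≤n+m i 4)))) deadline)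
  gather-deadline : phaseStart (5 + i) ≤ 1024 * D
  gather-deadline = ≤-trans (phaseStart-bound (5 + i)) deadline
  regroup : ∀ r → 16 * (2 * r) ≡ 2 * (2 * (2 * (2 * (2 * r))))
  regroup = ℕ-Solver.solve-∀
  D<2^j : D < 2 ^ (4 + i)
  D<2^j = ≤-<-trans D≤r (^-monoʳ-< 2 (s≤s (s≤s z≤n)) (m<n+m i {4} (s≤s z≤n)))
  by-delay : Dec (θ ≤ 2 * 2 ^ (4 + i)) → MeetsBy p q θ (1024 * D)
  by-delay (yes θ≤) = MeetsBy-mono p q θ gather-deadline (meet-by-gathering (4 + i) p q θ D D<2^j dir θ≤)
  by-delay (no  θ≰) = MeetsBy-mono p q θ sweep-deadline (meet-by-sweep i p q θ D D≤r dir sweep-before-wakeup)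
    where
    sweep-before-wakeup : phaseStart (suc i) ≤ θ
    sweep-before-wakeup = ≤-trans (phaseStart-bound (suc i)) (≤-trans (≤-reflexive (regroup r)) (<⇒≤ (≰⇒> θ≰)))

direction : ∀ p q → q ≡ p +ᶻ + ∣ p - q ∣ ⊎ p ≡ q +ᶻ + ∣ p - q ∣
direction p q with p - q in p-q≡
... | + n      = inj₂ (trans (via-difference p q) (cong (q +ᶻ_) p-q≡))
  where
  via-difference : ∀ p q → p ≡ q +ᶻ (p - q)
  via-difference = ℤ-Solver.solve-∀
... | -[1+ n ] = inj₁ (trans (via-difference p q) (cong (λ d → p - d) p-q≡))
  where
  via-difference : ∀ p q → q ≡ p - (p - q)
  via-difference = ℤ-Solver.solve-∀

mainTheorem1 : Σ Algorithm λ A → Σ ℕ λ c →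
    (p q : ℤ) (θ : ℕ) → p ≢ q →
    Σ ℕ λ t → (t ≤ c * ∣ p - q ∣) × (posGlobal A p 0 t ≡ posGlobal A q θ t)
mainTheorem1 = rendezvous , 1024 , λ p q θ p≢q →
  let D = ∣ p - q ∣
      (i , D≤2^i , 2^i≤2D) = dyadic-bracket D {{≢-nonZero (p≢q ∘ ℤ.i-j≡0⇒i≡j p q ∘ ℤ.∣i∣≡0⇒i≡0)}}
  in meets-within p q θ D i D≤2^i 2^i≤2D (direction p q)
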